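{- Let $p$ be a prime and $k,\ell\in\mathbb{N}$. If $G$ is a finite group containing two subgroups $H\cong\mathbb{Z}_p^k$ and $K\cong\mathbb{Z}_{p^\ell}$, then $|G|$ is divisible by $p^{k+\ell-1}$. -}

module Defs where

open import Level using (Level; _⊔_)
open import Data.Nat using (ℕ; zero; suc; _+_; _^_; _∸_)
open import Data.Nat.DivMod using (_mod_)
open import Data.Fin using (Fin; toℕ)
open import Data.Vec using (Vec; zipWith)
open import Data.Product using (∃)
open import Algebra.Bundles using (Group)
open import Relation.Binary.PropositionalEquality using (_≡_)

_⊕_ : {n : ℕ} → Fin n → Fin n → Fin n
_⊕_ {suc m} a b = (toℕ a + toℕ b) mod suc m

_⊕ᵛ_ : {n k : ℕ} → Vec (Fin n) k → Vec (Fin n) k → Vec (Fin n) k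
_⊕ᵛ_ = zipWith _⊕_

record FiniteGroup (c ℓ : Level) : Set (Level.suc (c ⊔ ℓ)) where
  field
    group     : Group c ℓ
    order     : ℕ
  open Group group public
  field
    enum      : Fin order → Carrier
    enum-inj  : ∀ i j → enum i ≈ enum j → i ≡ j
    enum-surj : ∀ x → ∃ λ i → enum i ≈ x

-- G has a subgroup isomorphic to ℤ_n^k  ⇔  there is an injective group
-- homomorphism ℤ_n^k → G (its image is such a subgroup, and conversely).
record HasSubgroupIsoℤⁿ^ {c ℓ} (G : FiniteGroup c ℓ) (n k : ℕ) : Set (c ⊔ ℓ) where
  open FiniteGroup G
  field
    φ       : Vec (Fin n) k → Carrier
    φ-hom   : ∀ x y → φ (x ⊕ᵛ y) ≈ (φ x ∙ φ y)
    φ-inj   : ∀ x y → φ x ≈ φ y → x ≡ y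

record HasSubgroupIsoℤ {c ℓ} (G : FiniteGroup c ℓ) (n : ℕ) : Set (c ⊔ ℓ) where
  open FiniteGroup G
  field
    ψ       : Fin n → Carrier
    ψ-hom   : ∀ x y → ψ (x ⊕ y) ≈ (ψ x ∙ ψ y)
    ψ-inj   : ∀ x y → ψ x ≈ ψ y → x ≡ y

-- Let H = φ(ℤ_p^k) and K = ψ(ℤ_{p^l}). The double cosets H r K partition G. Counting the pairs
-- (y , x) with x ∈ H r ψ(y) in two ways gives |H r K| · s = |H| |K| = p^(k+l), where
-- s = |{y : r ψ(y) ∈ H r}| = |K ∩ r⁻¹ H r|. Every element of r⁻¹ H r has order dividing p, and
-- ℤ_{p^l} has at most p such elements, so s ≤ p. As s divides p^(k+l), s is 1 or p; hence
-- p^(k+l-1) divides every |H r K|, and therefore |G|.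
module Submission where

open import Defs
open import Level using (Level)
open import Algebra.Bundles using (Group)
import Algebra.Properties.Semiring.Sum as SemiringSum
open import Data.Fin as Fin using (Fin; toℕ; fromℕ<; _≟_)
open import Data.Fin.Patterns using (0F)
open import Data.Fin.Permutation using (Permutation; permutation; _⟨$⟩ʳ_)
open import Data.Fin.Properties
  using (any?; 0≢1+n; suc-injective; toℕ-injective; toℕ-fromℕ<; toℕ<n)
open import Data.Nat
  using (ℕ; zero; suc; _+_; _*_; _^_; _∸_; _%_; _/_; _≤_; z≤n; s≤s; NonZero; ≢-nonZero⁻¹)
open import Data.Nat.Properties
  using ( +-*-semiring; +-comm; +-assoc; +-identityʳ; +-mono-≤; ≤-refl; ≤-trans; ≤-antisym
        ; ≤-reflexive; <-≤-trans; m≤n⇒m<n∨m≡n; *-identityʳ; *-identityˡ; *-zeroʳ; *-comm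
        ; *-cancelˡ-≡; ^-distribˡ-+-*; m^n≢0; m*n≢0⇒m≢0; module ≤-Reasoning)
open import Data.Nat.DivMod
  using (_mod_; %-distribˡ-+; m%n%n≡m%n; m*n%n≡0; m<n⇒m%n≡m; m/n*n≡m; m<n*o⇒m/o<n)
open import Data.Nat.Divisibility
  using (_∣_; divides; _∣0; 1∣_; ∣1⇒≡1; ∣-reflexive; ∣m∣n⇒∣m+n; n∣m*n; *-cancelˡ-∣; m%n≡0⇒n∣m)
open import Data.Nat.Coprimality as Coprime using (Coprime; coprime-divisor; prime⇒coprime)
open import Data.Nat.Primality using (Prime; ¬prime[0]; prime⇒nonZero)
open import Data.Product using (∃; _,_; proj₁; proj₂)
open import Data.Sum using (inj₁; inj₂)
open import Data.Unit using (tt)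
open import Data.Vec using (Vec; []; _∷_; map; replicate)
open import Data.Vec.Properties using (map-cong; map-const; zipWith-replicate)
open import Data.Vec.Recursive using (Fin[m^n]↔Fin[m]^n)
open import Data.Vec.Recursive.Properties using (↔Vec)
open import Function using (_∘_; _⇔_; mk⇔; Equivalence; Inverse; _↔_)
open import Function.Properties.Inverse using (↔-trans)
open import Relation.Binary using (Rel; Decidable; IsEquivalence)
open import Relation.Binary.PropositionalEquality
  using (_≡_; refl; sym; trans; cong; cong₂; subst; module ≡-Reasoning)
open import Relation.Nullary using (Dec; yes; no; ¬_; _×-dec_; contradiction)
import Relation.Nullary.Decidable as Dec
open import Relation.Unary using (Pred)
import Relation.Unary as U

open SemiringSum +-*-semiring
  using (sum; sum-cong-≗; ∑-comm; sum-permute; sum-replicate-zero; *-distribˡ-sum)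
open Equivalence using (to; from)

private variable
  a b ℓ : Level
  k m n : ℕ
  P : Pred (Fin n) a
  Q : Pred (Fin n) b

𝟙 : {A : Set a} → Dec A → ℕ
𝟙 (yes _) = 1
𝟙 (no  _) = 0

𝟙-mono : {A : Set a} {B : Set b} (A? : Dec A) (B? : Dec B) → (A → B) → 𝟙 A? ≤ 𝟙 B?
𝟙-mono (yes _) (yes _) _   = ≤-refl
𝟙-mono (yes x) (no ¬y) A⇒B = contradiction (A⇒B x) ¬y
𝟙-mono (no  _) _       _   = z≤n

𝟙-cong : {A : Set a} {B : Set b} (A? : Dec A) (B? : Dec B) → A ⇔ B → 𝟙 A? ≡ 𝟙 B?
𝟙-cong A? B? A⇔B = ≤-antisym (𝟙-mono A? B? (to A⇔B)) (𝟙-mono B? A? (from A⇔B))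

𝟙≤1 : {A : Set a} (A? : Dec A) → 𝟙 A? ≤ 1
𝟙≤1 (yes _) = ≤-refl
𝟙≤1 (no  _) = z≤n

𝟙-yes : {A : Set a} (A? : Dec A) → A → 𝟙 A? ≡ 1
𝟙-yes (yes _) _ = refl
𝟙-yes (no ¬x) x = contradiction x ¬x

𝟙-no : {A : Set a} (A? : Dec A) → ¬ A → 𝟙 A? ≡ 0
𝟙-no (yes x) ¬x = contradiction x ¬x
𝟙-no (no  _) _  = refl

sum-const : ∀ n k → sum {n} (λ _ → k) ≡ n * k
sum-const zero    k = refl
sum-const (suc n) k = cong (k +_) (sum-const n k)

sum-mono-≤ : {f g : Fin n → ℕ} → (∀ i → f i ≤ g i) → sum f ≤ sum g
sum-mono-≤ {zero}  f≤g = z≤n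
sum-mono-≤ {suc n} f≤g = +-mono-≤ (f≤g 0F) (sum-mono-≤ (f≤g ∘ Fin.suc))

sum-∣ : ∀ {d} (f : Fin n → ℕ) → (∀ i → d ∣ f i) → d ∣ sum f
sum-∣ {zero}  {d} f d∣f = d ∣0
sum-∣ {suc n}     f d∣f = ∣m∣n⇒∣m+n (d∣f 0F) (sum-∣ (f ∘ Fin.suc) (d∣f ∘ Fin.suc))

count : U.Decidable P → ℕ
count P? = sum (λ i → 𝟙 (P? i))

count-all : ∀ {n} → count (λ (_ : Fin n) → yes tt) ≡ n
count-all {n} = trans (sum-const n 1) (*-identityʳ n)

count-≡0 : (P? : U.Decidable P) → (∀ (i : Fin n) → ¬ P i) → count P? ≡ 0
count-≡0 {n = n} P? ∄P = trans (sum-cong-≗ (λ i → 𝟙-no (P? i) (∄P i))) (sum-replicate-zero n)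

count-cong : (P? : U.Decidable P) (Q? : U.Decidable Q) → (∀ i → P i ⇔ Q i) → count P? ≡ count Q?
count-cong P? Q? P⇔Q = sum-cong-≗ (λ i → 𝟙-cong (P? i) (Q? i) (P⇔Q i))

count-mono : (P? : U.Decidable P) (Q? : U.Decidable Q) → (∀ {i} → P i → Q i) → count P? ≤ count Q?
count-mono P? Q? P⇒Q = sum-mono-≤ (λ i → 𝟙-mono (P? i) (Q? i) P⇒Q)

count-permute : (P? : U.Decidable P) (Q? : U.Decidable Q) (π : Permutation n n) →
                (∀ i → P (π ⟨$⟩ʳ i) ⇔ Q i) → count P? ≡ count Q?
count-permute P? Q? π P∘π⇔Q = trans (sum-permute _ π) (count-cong (P? ∘ (π ⟨$⟩ʳ_)) Q? P∘π⇔Q)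

count-≡1 : (P? : U.Decidable P) {i₀ : Fin n} → P i₀ → (∀ {i} → P i → i ≡ i₀) → count P? ≡ 1
count-≡1 {n = suc n} P? {Fin.zero} p₀ unique rewrite 𝟙-yes (P? 0F) p₀ =
  cong suc (count-≡0 (P? ∘ Fin.suc) (λ i p → 0≢1+n (sym (unique p))))
count-≡1 {n = suc n} P? {Fin.suc i₀} p₀ unique rewrite 𝟙-no (P? 0F) (λ p → 0≢1+n (unique p)) =
  count-≡1 (P? ∘ Fin.suc) p₀ (suc-injective ∘ unique)

count-≡𝟙-any : (P? : U.Decidable P) → (∀ {i j} → P i → P j → i ≡ j) → count P? ≡ 𝟙 (any? P?)
count-≡𝟙-any P? atMostOne with any? P?
... | yes (i₀ , p₀) = count-≡1 P? p₀ (λ p → atMostOne p p₀)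
... | no  ∄P        = count-≡0 P? (λ i p → ∄P (i , p))

count-≤1 : (P? : U.Decidable P) → (∀ {i j} → P i → P j → i ≡ j) → count P? ≤ 1
count-≤1 P? atMostOne = ≤-trans (≤-reflexive (count-≡𝟙-any P? atMostOne)) (𝟙≤1 (any? P?))

count-fibres : (P? : U.Decidable P) (f : Fin n → Fin m) →
               count P? ≡ sum (λ j → count (λ i → P? i ×-dec f i ≟ j))
count-fibres P? f = trans (sum-cong-≗ fibre) (∑-comm (λ i j → 𝟙 (P? i ×-dec f i ≟ j)))
  where
  fibre : ∀ i → 𝟙 (P? i) ≡ count (λ j → P? i ×-dec f i ≟ j)
  fibre i with P? i
  ... | yes p = sym (count-≡1 (λ j → yes p ×-dec f i ≟ j) (p , refl) (sym ∘ proj₂))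
  ... | no ¬p = sym (count-≡0 (λ j → no ¬p ×-dec f i ≟ j) (λ j → ¬p ∘ proj₁))

count-≤-injection : (P? : U.Decidable P) (f : Fin n → Fin m) →
                    (∀ {i j} → P i → P j → f i ≡ f j → i ≡ j) → count P? ≤ m
count-≤-injection {m = m} P? f injective = begin
  count P?                                        ≡⟨ count-fibres P? f ⟩
  sum (λ j → count (λ i → P? i ×-dec f i ≟ j))    ≤⟨ sum-mono-≤ fibre≤1 ⟩
  sum {m} (λ _ → 1)                               ≡⟨ count-all ⟩
  m                                               ∎
  where
  open ≤-Reasoning
  fibre≤1 : ∀ j → count (λ i → P? i ×-dec f i ≟ j) ≤ 1
  fibre≤1 j = count-≤1 (λ i → P? i ×-dec f i ≟ j)
    (λ (p , fi≡j) (p′ , fi′≡j) → injective p p′ (trans fi≡j (sym fi′≡j)))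

sum-count-fibres : (f : Fin n → Fin m) → sum (λ j → count (λ i → f i ≟ j)) ≡ n
sum-count-fibres {n} f = begin
  sum (λ j → count (λ i → f i ≟ j))               ≡⟨ sum-cong-≗ drop-tt ⟩
  sum (λ j → count (λ i → yes tt ×-dec f i ≟ j))  ≡⟨ count-fibres (λ _ → yes tt) f ⟨
  count (λ (_ : Fin n) → yes tt)                  ≡⟨ count-all ⟩
  n                                               ∎
  where
  open ≡-Reasoning
  drop-tt : ∀ j → count (λ i → f i ≟ j) ≡ count (λ i → yes tt ×-dec f i ≟ j)
  drop-tt j = count-cong (λ i → f i ≟ j) (λ i → yes tt ×-dec f i ≟ j) (λ i → mk⇔ (tt ,_) proj₂)

count-image : (f : Fin m → Fin n) → (∀ {i j} → f i ≡ f j → i ≡ j) →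
              count (λ j → any? (λ i → f i ≟ j)) ≡ m
count-image f injective = trans (sum-cong-≗ fibre) (sum-count-fibres f)
  where
  fibre : ∀ j → 𝟙 (any? (λ i → f i ≟ j)) ≡ count (λ i → f i ≟ j)
  fibre j = sym (count-≡𝟙-any (λ i → f i ≟ j) (λ fi≡j fi′≡j → injective (trans fi≡j (sym fi′≡j))))

-- The least i satisfying P; 0F when there is none.
first : {P : Pred (Fin (suc n)) a} → U.Decidable P → Fin (suc n)
first {n = zero}  P? = 0F
first {n = suc n} P? with P? 0F
... | yes _ = 0F
... | no  _ = Fin.suc (first (P? ∘ Fin.suc))

first-satisfies : {P : Pred (Fin (suc n)) a} (P? : U.Decidable P) {i : Fin (suc n)} →
                  P i → P (first P?)
first-satisfies {n = zero}  P? {0F} p = p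
first-satisfies {n = suc n} P? p with P? 0F
first-satisfies {n = suc n} P?             p | yes p₀  = p₀
first-satisfies {n = suc n} P? {0F}        p | no  ¬p₀ = contradiction p ¬p₀
first-satisfies {n = suc n} P? {Fin.suc i} p | no  _   = first-satisfies (P? ∘ Fin.suc) p

first-cong : {P : Pred (Fin (suc n)) a} {Q : Pred (Fin (suc n)) b}
             (P? : U.Decidable P) (Q? : U.Decidable Q) → (∀ i → P i ⇔ Q i) → first P? ≡ first Q?
first-cong {n = zero}  P? Q? P⇔Q = refl
first-cong {n = suc n} P? Q? P⇔Q with P? 0F | Q? 0F
... | yes _ | yes _  = refl
... | yes p | no ¬q  = contradiction (to (P⇔Q 0F) p) ¬q
... | no ¬p | yes q  = contradiction (from (P⇔Q 0F) q) ¬p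
... | no _  | no _   = cong Fin.suc (first-cong (P? ∘ Fin.suc) (Q? ∘ Fin.suc) (P⇔Q ∘ Fin.suc))

∣-classSizes⇒∣ : ∀ {d} {R : Rel (Fin n) ℓ} (R? : Decidable R) → IsEquivalence R →
                 (∀ x → d ∣ count (R? x)) → d ∣ n
∣-classSizes⇒∣ {n = zero}  {d = d}         R? _       _         = d ∣0
∣-classSizes⇒∣ {n = suc n} {d = d} {R = R} R? R-equiv d∣class =
  -- the fibres of y ↦ least element of its class are the classes and the empty set
  subst (d ∣_) (sum-count-fibres rep) (sum-∣ _ d∣fibre)
  where
  open IsEquivalence R-equiv renaming (refl to R-refl; sym to R-sym; trans to R-trans)

  rep : Fin (suc n) → Fin (suc n)
  rep y = first (λ i → R? i y)

  rep-∼ : ∀ y → R (rep y) y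
  rep-∼ y = first-satisfies (λ i → R? i y) R-refl

  rep-cong : ∀ {y y′} → R y y′ → rep y ≡ rep y′
  rep-cong {y} {y′} y∼y′ = first-cong (λ i → R? i y) (λ i → R? i y′)
    (λ i → mk⇔ (λ i∼y → R-trans i∼y y∼y′) (λ i∼y′ → R-trans i∼y′ (R-sym y∼y′)))

  class⇔fibre : ∀ y₀ y → R (rep y₀) y ⇔ rep y ≡ rep y₀
  class⇔fibre y₀ y = mk⇔ (λ r∼y → sym (rep-cong (R-trans (R-sym (rep-∼ y₀)) r∼y)))
                         (λ eq → subst (λ r → R r y) eq (rep-∼ y))

  d∣fibre : ∀ x → d ∣ count (λ y → rep y ≟ x)
  d∣fibre x with any? (λ y → rep y ≟ x)
  ... | yes (y₀ , refl) = subst (d ∣_) (count-cong (R? (rep y₀)) (λ y → rep y ≟ rep y₀) (class⇔fibre y₀))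
                                (d∣class (rep y₀))
  ... | no ∄y = subst (d ∣_) (sym (count-≡0 (λ y → rep y ≟ x) (λ y eq → ∄y (y , eq)))) (d ∣0)

infixr 8 _·_ _·ᵛ_

_·_ : ℕ → Fin n → Fin n
_·_ {suc m} j a = (j * toℕ a) mod suc m

_·ᵛ_ : ℕ → Vec (Fin n) k → Vec (Fin n) k
j ·ᵛ v = map (j ·_) v

0ᵛ : Vec (Fin (suc m)) k
0ᵛ {k = k} = replicate k 0F

toℕ-mod : ∀ x → toℕ (x mod suc m) ≡ x % suc m
toℕ-mod x = toℕ-fromℕ< _

[m+n%d]%d≡[m+n]%d : ∀ m n d .{{_ : NonZero d}} → (m + n % d) % d ≡ (m + n) % d
[m+n%d]%d≡[m+n]%d m n d = begin
  (m + n % d) % d            ≡⟨ %-distribˡ-+ m (n % d) d ⟩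
  (m % d + n % d % d) % d    ≡⟨ cong (λ t → (m % d + t) % d) (m%n%n≡m%n n d) ⟩
  (m % d + n % d) % d        ≡⟨ %-distribˡ-+ m n d ⟨
  (m + n) % d                ∎
  where open ≡-Reasoning

[m%d+n]%d≡[m+n]%d : ∀ m n d .{{_ : NonZero d}} → (m % d + n) % d ≡ (m + n) % d
[m%d+n]%d≡[m+n]%d m n d = begin
  (m % d + n) % d   ≡⟨ cong (_% d) (+-comm (m % d) n) ⟩
  (n + m % d) % d   ≡⟨ [m+n%d]%d≡[m+n]%d n m d ⟩
  (n + m) % d       ≡⟨ cong (_% d) (+-comm n m) ⟩
  (m + n) % d       ∎
  where open ≡-Reasoning

⊕-comm : ∀ (a b : Fin n) → a ⊕ b ≡ b ⊕ a
⊕-comm {suc m} a b = cong (_mod suc m) (+-comm (toℕ a) (toℕ b))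

⊕-assoc : ∀ (a b c : Fin n) → (a ⊕ b) ⊕ c ≡ a ⊕ (b ⊕ c)
⊕-assoc {suc m} a b c = toℕ-injective (begin
  toℕ ((a ⊕ b) ⊕ c)                          ≡⟨ toℕ-mod (toℕ (a ⊕ b) + z) ⟩
  (toℕ (a ⊕ b) + z) % N                      ≡⟨ cong (λ t → (t + z) % N) (toℕ-mod (x + y)) ⟩
  ((x + y) % N + z) % N                      ≡⟨ [m%d+n]%d≡[m+n]%d (x + y) z N ⟩
  (x + y + z) % N                            ≡⟨ cong (_% N) (+-assoc x y z) ⟩
  (x + (y + z)) % N                          ≡⟨ [m+n%d]%d≡[m+n]%d x (y + z) N ⟨
  (x + (y + z) % N) % N                      ≡⟨ cong (λ t → (x + t) % N) (toℕ-mod (y + z)) ⟨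
  (x + toℕ (b ⊕ c)) % N                      ≡⟨ toℕ-mod (x + toℕ (b ⊕ c)) ⟨
  toℕ (a ⊕ (b ⊕ c))                          ∎)
  where
  open ≡-Reasoning
  N = suc m
  x = toℕ a
  y = toℕ b
  z = toℕ c

⊕-identityʳ : ∀ (a : Fin (suc m)) → a ⊕ 0F ≡ a
⊕-identityʳ {m} a = toℕ-injective (begin
  toℕ (a ⊕ 0F)          ≡⟨ toℕ-mod (toℕ a + 0) ⟩
  (toℕ a + 0) % suc m   ≡⟨ cong (_% suc m) (+-identityʳ (toℕ a)) ⟩
  toℕ a % suc m         ≡⟨ m<n⇒m%n≡m (toℕ<n a) ⟩
  toℕ a                 ∎)
  where open ≡-Reasoning

·-suc : ∀ j (a : Fin n) → a ⊕ (j · a) ≡ suc j · a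
·-suc {suc m} j a = toℕ-injective (begin
  toℕ (a ⊕ (j · a))          ≡⟨ toℕ-mod (x + toℕ (j · a)) ⟩
  (x + toℕ (j · a)) % N      ≡⟨ cong (λ t → (x + t) % N) (toℕ-mod (j * x)) ⟩
  (x + (j * x) % N) % N      ≡⟨ [m+n%d]%d≡[m+n]%d x (j * x) N ⟩
  (x + j * x) % N            ≡⟨ toℕ-mod (suc j * x) ⟨
  toℕ (suc j · a)            ∎)
  where
  open ≡-Reasoning
  N = suc m
  x = toℕ a

[1+m]·a≡0 : ∀ (a : Fin (suc m)) → suc m · a ≡ 0F
[1+m]·a≡0 {m} a = toℕ-injective (begin
  toℕ (suc m · a)          ≡⟨ toℕ-mod (suc m * toℕ a) ⟩
  (suc m * toℕ a) % suc m  ≡⟨ cong (_% suc m) (*-comm (suc m) (toℕ a)) ⟩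
  (toℕ a * suc m) % suc m  ≡⟨ m*n%n≡0 (toℕ a) (suc m) ⟩
  0                        ∎)
  where open ≡-Reasoning

⊕-inverseʳ : ∀ (a : Fin (suc m)) → a ⊕ (m · a) ≡ 0F
⊕-inverseʳ {m} a = trans (·-suc m a) ([1+m]·a≡0 a)

translation : Fin (suc m) → Permutation (suc m) (suc m)
translation {m} y₀ = permutation (_⊕ y₀) (_⊕ (m · y₀)) left right
  where
  open ≡-Reasoning
  left : ∀ y → (y ⊕ (m · y₀)) ⊕ y₀ ≡ y
  left y = begin
    (y ⊕ (m · y₀)) ⊕ y₀   ≡⟨ ⊕-assoc y (m · y₀) y₀ ⟩
    y ⊕ ((m · y₀) ⊕ y₀)   ≡⟨ cong (y ⊕_) (trans (⊕-comm (m · y₀) y₀) (⊕-inverseʳ y₀)) ⟩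
    y ⊕ 0F                ≡⟨ ⊕-identityʳ y ⟩
    y                     ∎
  right : ∀ y → (y ⊕ y₀) ⊕ (m · y₀) ≡ y
  right y = begin
    (y ⊕ y₀) ⊕ (m · y₀)   ≡⟨ ⊕-assoc y y₀ (m · y₀) ⟩
    y ⊕ (y₀ ⊕ (m · y₀))   ≡⟨ cong (y ⊕_) (⊕-inverseʳ y₀) ⟩
    y ⊕ 0F                ≡⟨ ⊕-identityʳ y ⟩
    y                     ∎

·ᵛ-suc : ∀ j (v : Vec (Fin n) k) → v ⊕ᵛ (j ·ᵛ v) ≡ suc j ·ᵛ v
·ᵛ-suc j []      = refl
·ᵛ-suc j (a ∷ v) = cong₂ _∷_ (·-suc j a) (·ᵛ-suc j v)

0·ᵛv≡0ᵛ : ∀ (v : Vec (Fin (suc m)) k) → 0 ·ᵛ v ≡ 0ᵛ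
0·ᵛv≡0ᵛ v = map-const v 0F

[1+m]·ᵛv≡0ᵛ : ∀ (v : Vec (Fin (suc m)) k) → suc m ·ᵛ v ≡ 0ᵛ
[1+m]·ᵛv≡0ᵛ v = trans (map-cong [1+m]·a≡0 v) (map-const v 0F)

0ᵛ⊕0ᵛ≡0ᵛ : 0ᵛ {m} {k} ⊕ᵛ 0ᵛ ≡ 0ᵛ
0ᵛ⊕0ᵛ≡0ᵛ = zipWith-replicate _⊕_ 0F 0F

p^n≤p*p^[n∸1] : ∀ p n .{{_ : NonZero p}} → p ^ n ≤ p * p ^ (n ∸ 1)
p^n≤p*p^[n∸1] (suc p) zero    = s≤s z≤n
p^n≤p*p^[n∸1] p       (suc n) = ≤-refl

p^n∣p*m⇒p^[n∸1]∣m : ∀ p n {m} .{{_ : NonZero p}} → p ^ n ∣ p * m → p ^ (n ∸ 1) ∣ m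
p^n∣p*m⇒p^[n∸1]∣m p zero    {m} _       = 1∣ m
p^n∣p*m⇒p^[n∸1]∣m p (suc n)     p^n∣p*m = *-cancelˡ-∣ p p^n∣p*m

count-torsion≤ : ∀ p l .{{_ : NonZero p}} → suc m ≡ p ^ l →
                 count (λ (y : Fin (suc m)) → p · y ≟ 0F) ≤ p
count-torsion≤ {m} p l n≡p^l = count-≤-injection (λ y → p · y ≟ 0F) digit digit-injective
  where
  d : ℕ
  d = p ^ (l ∸ 1)
  instance
    _ = m^n≢0 p (l ∸ 1)

  torsion⇒d∣ : ∀ {y} → p · y ≡ 0F → d ∣ toℕ y
  torsion⇒d∣ {y} py≡0 = p^n∣p*m⇒p^[n∸1]∣m p l (subst (_∣ p * toℕ y) n≡p^l
    (m%n≡0⇒n∣m (p * toℕ y) (suc m) (trans (sym (toℕ-mod (p * toℕ y))) (cong toℕ py≡0))))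

  n≤p*d : suc m ≤ p * d
  n≤p*d = ≤-trans (≤-reflexive n≡p^l) (p^n≤p*p^[n∸1] p l)

  -- A p-torsion y is a multiple of d = p^(l-1) below p d, so it is determined by y / d.
  digit : Fin (suc m) → Fin p
  digit y = fromℕ< (m<n*o⇒m/o<n (<-≤-trans (toℕ<n y) n≤p*d))

  toℕ-digit : ∀ y → toℕ (digit y) ≡ toℕ y / d
  toℕ-digit y = toℕ-fromℕ< _

  digit-injective : ∀ {y y′} → p · y ≡ 0F → p · y′ ≡ 0F → digit y ≡ digit y′ → y ≡ y′
  digit-injective {y} {y′} py≡0 py′≡0 same-digit = toℕ-injective (begin
    toℕ y            ≡⟨ m/n*n≡m (torsion⇒d∣ py≡0) ⟨
    toℕ y / d * d    ≡⟨ cong (_* d) y/d≡y′/d ⟩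
    toℕ y′ / d * d   ≡⟨ m/n*n≡m (torsion⇒d∣ py′≡0) ⟩
    toℕ y′           ∎)
    where
    open ≡-Reasoning
    y/d≡y′/d : toℕ y / d ≡ toℕ y′ / d
    y/d≡y′/d = trans (sym (toℕ-digit y)) (trans (cong toℕ same-digit) (toℕ-digit y′))

coprime∧∣^⇒∣1 : ∀ {s p} t → Coprime s p → s ∣ p ^ t → s ∣ 1
coprime∧∣^⇒∣1 zero    _       s∣1       = s∣1
coprime∧∣^⇒∣1 (suc t) coprime s∣p^1+t = coprime∧∣^⇒∣1 t coprime (coprime-divisor coprime s∣p^1+t)

p^[n∸1]∣p^n : ∀ p n → p ^ (n ∸ 1) ∣ p ^ n
p^[n∸1]∣p^n p zero    = ∣-reflexive refl
p^[n∸1]∣p^n p (suc n) = n∣m*n p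

s*c≡p^t⇒p^[t∸1]∣c : ∀ {p s c} t → Prime p → s * c ≡ p ^ t → s ≤ p → p ^ (t ∸ 1) ∣ c
s*c≡p^t⇒p^[t∸1]∣c {p} {s} {c} t p-prime s*c≡p^t s≤p with m≤n⇒m<n∨m≡n s≤p
... | inj₂ refl = p*c≡p^t⇒p^[t∸1]∣c t s*c≡p^t
  where
  instance _ = prime⇒nonZero p-prime
  p*c≡p^t⇒p^[t∸1]∣c : ∀ t → p * c ≡ p ^ t → p ^ (t ∸ 1) ∣ c
  p*c≡p^t⇒p^[t∸1]∣c zero    _         = 1∣ c
  p*c≡p^t⇒p^[t∸1]∣c (suc t) p*c≡p^1+t = ∣-reflexive (sym (*-cancelˡ-≡ c (p ^ t) p p*c≡p^1+t))
... | inj₁ s<p = subst (p ^ (t ∸ 1) ∣_) p^t≡c (p^[n∸1]∣p^n p t)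
  where
  instance
    _ = prime⇒nonZero p-prime
    _ : NonZero s
    _ = m*n≢0⇒m≢0 s {{subst NonZero (sym s*c≡p^t) (m^n≢0 p t)}}
  s∣p^t : s ∣ p ^ t
  s∣p^t = divides c (trans (sym s*c≡p^t) (*-comm s c))
  s≡1 : s ≡ 1
  s≡1 = ∣1⇒≡1 (coprime∧∣^⇒∣1 t (Coprime.sym (prime⇒coprime p-prime s<p)) s∣p^t)
  p^t≡c : p ^ t ≡ c
  p^t≡c = trans (sym s*c≡p^t) (trans (cong (_* c) s≡1) (*-identityˡ c))

module GroupProperties {c ℓ} (G : Group c ℓ) where
  open Group G renaming (refl to ≈-refl; sym to ≈-sym; trans to ≈-trans)
  open import Algebra.Properties.Group G
    using (inverseʳ-unique; identityʳ-unique; y≈x\\z; ⁻¹-anti-homo-∙)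
  open import Algebra.Definitions.RawMonoid rawMonoid public using () renaming (_×_ to _×ᴳ_)
  open import Algebra.Properties.Monoid.Mult monoid public using (×-congʳ)
  open import Relation.Binary.Reasoning.Setoid setoid

  conj-×ᴳ : ∀ j g h → j ×ᴳ (g ⁻¹ ∙ (h ∙ g)) ≈ g ⁻¹ ∙ (j ×ᴳ h ∙ g)
  conj-×ᴳ zero    g h = ≈-sym (≈-trans (∙-congˡ (identityˡ g)) (inverseˡ g))
  conj-×ᴳ (suc j) g h = begin
    (g ⁻¹ ∙ (h ∙ g)) ∙ j ×ᴳ (g ⁻¹ ∙ (h ∙ g))    ≈⟨ ∙-congˡ (conj-×ᴳ j g h) ⟩
    (g ⁻¹ ∙ (h ∙ g)) ∙ (g ⁻¹ ∙ (j ×ᴳ h ∙ g))    ≈⟨ assoc _ _ _ ⟩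
    g ⁻¹ ∙ ((h ∙ g) ∙ (g ⁻¹ ∙ (j ×ᴳ h ∙ g)))    ≈⟨ ∙-congˡ (assoc _ _ _) ⟩
    g ⁻¹ ∙ (h ∙ (g ∙ (g ⁻¹ ∙ (j ×ᴳ h ∙ g))))    ≈⟨ ∙-congˡ (∙-congˡ (assoc _ _ _)) ⟨
    g ⁻¹ ∙ (h ∙ ((g ∙ g ⁻¹) ∙ (j ×ᴳ h ∙ g)))    ≈⟨ ∙-congˡ (∙-congˡ (∙-congʳ (inverseʳ g))) ⟩
    g ⁻¹ ∙ (h ∙ (ε ∙ (j ×ᴳ h ∙ g)))             ≈⟨ ∙-congˡ (∙-congˡ (identityˡ _)) ⟩
    g ⁻¹ ∙ (h ∙ (j ×ᴳ h ∙ g))                   ≈⟨ ∙-congˡ (assoc _ _ _) ⟨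
    g ⁻¹ ∙ ((h ∙ j ×ᴳ h) ∙ g)                   ∎

  ∙-∙⁻¹-cancel : ∀ g t → (g ∙ t) ∙ t ⁻¹ ≈ g
  ∙-∙⁻¹-cancel g t = ≈-trans (assoc _ _ _) (≈-trans (∙-congˡ (inverseʳ t)) (identityʳ g))

  module HomomorphismPowers
    {a} {A : Set a} (_⊞_ : A → A → A) (o : A) (o⊞o≡o : o ⊞ o ≡ o)
    (_·_ : ℕ → A → A) (0·x≡o : ∀ x → 0 · x ≡ o) (·-suc : ∀ j x → x ⊞ (j · x) ≡ suc j · x)
    (f : A → Carrier) (f-hom : ∀ x y → f (x ⊞ y) ≈ f x ∙ f y) where

    f-o : f o ≈ ε
    f-o = identityʳ-unique (f o) (f o) (≈-trans (≈-sym (f-hom o o)) (reflexive (cong f o⊞o≡o)))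

    f-· : ∀ j x → f (j · x) ≈ j ×ᴳ f x
    f-· zero    x = ≈-trans (reflexive (cong f (0·x≡o x))) f-o
    f-· (suc j) x = begin
      f (suc j · x)     ≡⟨ cong f (·-suc j x) ⟨
      f (x ⊞ (j · x))   ≈⟨ f-hom x (j · x) ⟩
      f x ∙ f (j · x)   ≈⟨ ∙-congˡ (f-· j x) ⟩
      f x ∙ j ×ᴳ f x    ∎

    f-inverse : ∀ {j x} → suc j · x ≡ o → f (j · x) ≈ f x ⁻¹
    f-inverse {j} {x} [1+j]·x≡o = inverseʳ-unique (f x) (f (j · x)) (begin
      f x ∙ f (j · x)   ≈⟨ f-hom x (j · x) ⟨
      f (x ⊞ (j · x))   ≡⟨ cong f (trans (·-suc j x) [1+j]·x≡o) ⟩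
      f o               ≈⟨ f-o ⟩
      ε                 ∎)

  module RightCosets
    {a} {V : Set a} (φ : V → Carrier) (_⊞_ : V → V → V) (o : V) (-_ : V → V)
    (φ-hom : ∀ v w → φ (v ⊞ w) ≈ φ v ∙ φ w) (φ-o : φ o ≈ ε) (φ-neg : ∀ v → φ (- v) ≈ φ v ⁻¹)
    where

    infix 4 _∈H·_
    _∈H·_ : Carrier → Carrier → Set _
    g ∈H· g′ = ∃ λ v → φ v ∙ g′ ≈ g

    ∈H·-refl : ∀ {g} → g ∈H· g
    ∈H·-refl = o , ≈-trans (∙-congʳ φ-o) (identityˡ _)

    ∈H·-sym : ∀ {g g′} → g ∈H· g′ → g′ ∈H· g
    ∈H·-sym {g} {g′} (v , φv∙g′≈g) = - v , (begin
      φ (- v) ∙ g            ≈⟨ ∙-cong (φ-neg v) (≈-sym φv∙g′≈g) ⟩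
      φ v ⁻¹ ∙ (φ v ∙ g′)    ≈⟨ assoc _ _ _ ⟨
      (φ v ⁻¹ ∙ φ v) ∙ g′    ≈⟨ ∙-congʳ (inverseˡ _) ⟩
      ε ∙ g′                 ≈⟨ identityˡ g′ ⟩
      g′                     ∎)

    ∈H·-trans : ∀ {g g′ g″} → g ∈H· g′ → g′ ∈H· g″ → g ∈H· g″
    ∈H·-trans {g} {g′} {g″} (v , φv∙g′≈g) (v′ , φv′∙g″≈g′) = v ⊞ v′ , (begin
      φ (v ⊞ v′) ∙ g″       ≈⟨ ∙-congʳ (φ-hom v v′) ⟩
      (φ v ∙ φ v′) ∙ g″     ≈⟨ assoc _ _ _ ⟩
      φ v ∙ (φ v′ ∙ g″)     ≈⟨ ∙-congˡ φv′∙g″≈g′ ⟩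
      φ v ∙ g′              ≈⟨ φv∙g′≈g ⟩
      g                     ∎)

    ∈H·-resp : ∀ {g₁ g₂ g₁′ g₂′} → g₁ ≈ g₂ → g₁′ ≈ g₂′ → g₁ ∈H· g₁′ → g₂ ∈H· g₂′
    ∈H·-resp g₁≈g₂ g₁′≈g₂′ (v , φv∙g₁′≈g₁) =
      v , ≈-trans (∙-congˡ (≈-sym g₁′≈g₂′)) (≈-trans φv∙g₁′≈g₁ g₁≈g₂)

    ∈H·-∙ʳ : ∀ {g g′} t → g ∈H· g′ → g ∙ t ∈H· g′ ∙ t
    ∈H·-∙ʳ t (v , φv∙g′≈g) = v , ≈-trans (≈-sym (assoc _ _ _)) (∙-congʳ φv∙g′≈g)

    ∈H·-∙ʳ⁻¹ : ∀ {g g′} t → g ∙ t ∈H· g′ ∙ t → g ∈H· g′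
    ∈H·-∙ʳ⁻¹ t g∙t∈ = ∈H·-resp (∙-∙⁻¹-cancel _ t) (∙-∙⁻¹-cancel _ t) (∈H·-∙ʳ (t ⁻¹) g∙t∈)

    ∈H·-conjugate : ∀ {g t} → g ∈H· g ∙ t → ∃ λ v → t ≈ g ⁻¹ ∙ (φ v ∙ g)
    ∈H·-conjugate {g} {t} (v , φv∙[g∙t]≈g) = - v , (begin
      t                       ≈⟨ y≈x\\z (φ v ∙ g) t g (≈-trans (assoc _ _ _) φv∙[g∙t]≈g) ⟩
      (φ v ∙ g) ⁻¹ ∙ g        ≈⟨ ∙-congʳ (⁻¹-anti-homo-∙ (φ v) g) ⟩
      (g ⁻¹ ∙ φ v ⁻¹) ∙ g     ≈⟨ assoc _ _ _ ⟩
      g ⁻¹ ∙ (φ v ⁻¹ ∙ g)     ≈⟨ ∙-congˡ (∙-congʳ (φ-neg v)) ⟨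
      g ⁻¹ ∙ (φ (- v) ∙ g)    ∎)

module FiniteGroupProperties {c ℓ} (G : FiniteGroup c ℓ) where
  open FiniteGroup G renaming (refl to ≈-refl; sym to ≈-sym; trans to ≈-trans)

  index : Carrier → Fin order
  index x = proj₁ (enum-surj x)

  enum-index : ∀ x → enum (index x) ≈ x
  enum-index x = proj₂ (enum-surj x)

  index-cong : ∀ {x y} → x ≈ y → index x ≡ index y
  index-cong x≈y = enum-inj _ _ (≈-trans (enum-index _) (≈-trans x≈y (≈-sym (enum-index _))))

  index-injective : ∀ {x y} → index x ≡ index y → x ≈ y
  index-injective {x} {y} eq =
    ≈-trans (≈-sym (enum-index x)) (≈-trans (reflexive (cong enum eq)) (enum-index y))

  index-enum : ∀ i → index (enum i) ≡ i
  index-enum i = enum-inj _ _ (enum-index (enum i))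

  infix 4 _≈?_
  _≈?_ : Decidable _≈_
  x ≈? y = Dec.map′ index-injective index-cong (index x ≟ index y)

  count-image-≈ : ∀ {M} (f : Fin M → Carrier) → (∀ {i j} → f i ≈ f j → i ≡ j) →
                  count (λ b → any? (λ i → f i ≈? enum b)) ≡ M
  count-image-≈ f f-injective = trans
    (count-cong (λ b → any? (λ i → f i ≈? enum b)) (λ b → any? (λ i → index (f i) ≟ b)) image⇔)
    (count-image (index ∘ f) (f-injective ∘ index-injective))
    where
    image⇔ : ∀ b → (∃ λ i → f i ≈ enum b) ⇔ (∃ λ i → index (f i) ≡ b)
    image⇔ b = mk⇔ (λ (i , fi≈b) → i , trans (index-cong fi≈b) (index-enum b))
                   (λ (i , idx≡b) → i , index-injective (trans idx≡b (sym (index-enum b))))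

module DoubleCosets {c ℓ} (G : FiniteGroup c ℓ) {q k m : ℕ}
  (H : HasSubgroupIsoℤⁿ^ G (suc q) k) (K : HasSubgroupIsoℤ G (suc m)) where

  open FiniteGroup G renaming (refl to ≈-refl; sym to ≈-sym; trans to ≈-trans)
  open HasSubgroupIsoℤⁿ^ H
  open HasSubgroupIsoℤ K
  open GroupProperties group
  open import Algebra.Properties.Group group using (∙-cancelʳ)
  open FiniteGroupProperties G

  p : ℕ
  p = suc q

  module Φ = HomomorphismPowers _⊕ᵛ_ 0ᵛ 0ᵛ⊕0ᵛ≡0ᵛ _·ᵛ_ 0·ᵛv≡0ᵛ ·ᵛ-suc φ φ-hom
  module Ψ = HomomorphismPowers _⊕_ 0F refl _·_ (λ _ → refl) ·-suc ψ ψ-hom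

  open RightCosets φ _⊕ᵛ_ 0ᵛ (q ·ᵛ_) φ-hom Φ.f-o (λ v → Φ.f-inverse {j = q} ([1+m]·ᵛv≡0ᵛ v))

  vectors : Fin (p ^ k) ↔ Vec (Fin p) k
  vectors = ↔-trans (Fin[m^n]↔Fin[m]^n p k) (↔Vec k)

  open Inverse vectors
    using (strictlyInverseˡ; strictlyInverseʳ) renaming (to to vector; from to index-of)

  vector-injective : ∀ {i j} → vector i ≡ vector j → i ≡ j
  vector-injective {i} {j} eq =
    trans (sym (strictlyInverseʳ i)) (trans (cong index-of eq) (strictlyInverseʳ j))

  ∃index⇔∈H· : ∀ g g′ → (∃ λ i → φ (vector i) ∙ g′ ≈ g) ⇔ g ∈H· g′
  ∃index⇔∈H· g g′ = mk⇔ (λ (i , eq) → vector i , eq) (λ (v , φv∙g′≈g) →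
    index-of v , ≈-trans (∙-congʳ (reflexive (cong φ (strictlyInverseˡ v)))) φv∙g′≈g)

  infix 4 _∈H·?_
  _∈H·?_ : ∀ g g′ → Dec (g ∈H· g′)
  g ∈H·? g′ = Dec.map (∃index⇔∈H· g g′) (any? (λ i → φ (vector i) ∙ g′ ≈? g))

  |H·g| : ∀ g → count (λ b → enum b ∈H·? g) ≡ p ^ k
  |H·g| g = begin
    count (λ b → enum b ∈H·? g)                  ≡⟨ count-cong _ _ (λ b → ∃index⇔∈H· (enum b) g) ⟨
    count (λ b → any? (λ i → f i ≈? enum b))     ≡⟨ count-image-≈ f f-injective ⟩
    p ^ k                                        ∎
    where
    open ≡-Reasoning
    f : Fin (p ^ k) → Carrier
    f i = φ (vector i) ∙ g
    f-injective : ∀ {i j} → f i ≈ f j → i ≡ j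
    f-injective = vector-injective ∘ φ-inj _ _ ∘ ∙-cancelʳ g _ _

  ∙ψ0 : ∀ g → g ∙ ψ 0F ≈ g
  ∙ψ0 g = ≈-trans (∙-congˡ Ψ.f-o) (identityʳ g)

  ∙ψ-⊕ : ∀ g y y′ → (g ∙ ψ y) ∙ ψ y′ ≈ g ∙ ψ (y ⊕ y′)
  ∙ψ-⊕ g y y′ = ≈-trans (assoc _ _ _) (∙-congˡ (≈-sym (ψ-hom y y′)))

  ∈H·-shift : ∀ {g g′} y y′ → g ∈H· g′ ∙ ψ y → g ∙ ψ y′ ∈H· g′ ∙ ψ (y ⊕ y′)
  ∈H·-shift y y′ g∈ = ∈H·-resp ≈-refl (∙ψ-⊕ _ y y′) (∈H·-∙ʳ (ψ y′) g∈)

  ∈H·-unshift : ∀ {g g′} y y′ → g ∙ ψ y′ ∈H· g′ ∙ ψ (y ⊕ y′) → g ∈H· g′ ∙ ψ y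
  ∈H·-unshift y y′ g∈ = ∈H·-∙ʳ⁻¹ (ψ y′) (∈H·-resp ≈-refl (≈-sym (∙ψ-⊕ _ y y′)) g∈)

  infix 4 _∼_ _∼?_
  _∼_ : Rel (Fin order) _
  a ∼ b = ∃ λ y → enum b ∈H· enum a ∙ ψ y

  _∼?_ : Decidable _∼_
  a ∼? b = any? (λ y → enum b ∈H·? enum a ∙ ψ y)

  ∼-isEquivalence : IsEquivalence _∼_
  ∼-isEquivalence = record
    { refl  = 0F , ∈H·-resp ≈-refl (≈-sym (∙ψ0 _)) ∈H·-refl
    ; sym   = λ (y , b∈) →
                m · y , ∈H·-sym (∈H·-resp ≈-refl (∙ψ-inverse _ y) (∈H·-shift y (m · y) b∈))
    ; trans = λ (y , b∈) (y′ , c∈) → y ⊕ y′ , ∈H·-trans c∈ (∈H·-shift y y′ b∈)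
    }
    where
    ∙ψ-inverse : ∀ g y → g ∙ ψ (y ⊕ (m · y)) ≈ g
    ∙ψ-inverse g y = ≈-trans (∙-congˡ (reflexive (cong ψ (⊕-inverseʳ y)))) (∙ψ0 g)

  stab : Fin order → ℕ
  stab r = count (λ y → enum r ∈H·? enum r ∙ ψ y)

  hits : Fin order → Fin order → ℕ
  hits r x = count (λ y → enum x ∈H·? enum r ∙ ψ y)

  hits≡stab : ∀ {r x} → r ∼ x → hits r x ≡ stab r
  hits≡stab {r} {x} (y₀ , x∈) =
    count-permute (λ y → enum x ∈H·? enum r ∙ ψ y) (λ y → enum r ∈H·? enum r ∙ ψ y) (translation y₀)
      (λ y → mk⇔ (λ x∈′ → ∈H·-unshift y y₀ (∈H·-trans (∈H·-sym x∈) x∈′))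
                 (λ r∈ → ∈H·-trans x∈ (∈H·-shift y y₀ r∈)))

  hits≡stab*𝟙 : ∀ r x → hits r x ≡ stab r * 𝟙 (r ∼? x)
  hits≡stab*𝟙 r x with r ∼? x
  ... | yes r∼x = trans (hits≡stab r∼x) (sym (*-identityʳ (stab r)))
  ... | no  r≁x = trans (count-≡0 (λ y → enum x ∈H·? enum r ∙ ψ y) (λ y x∈ → r≁x (y , x∈)))
                        (sym (*-zeroʳ (stab r)))

  orbit-stabiliser : ∀ r → stab r * count (r ∼?_) ≡ suc m * p ^ k
  orbit-stabiliser r = begin
    stab r * count (r ∼?_)            ≡⟨ *-distribˡ-sum (stab r) (𝟙 ∘ (r ∼?_)) ⟩
    sum (λ x → stab r * 𝟙 (r ∼? x))   ≡⟨ sum-cong-≗ (sym ∘ hits≡stab*𝟙 r) ⟩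
    sum (λ x → sum (λ y → hit x y))   ≡⟨ ∑-comm hit ⟩
    sum (λ y → sum (λ x → hit x y))   ≡⟨ sum-cong-≗ (λ y → |H·g| (enum r ∙ ψ y)) ⟩
    sum {suc m} (λ _ → p ^ k)         ≡⟨ sum-const (suc m) (p ^ k) ⟩
    suc m * p ^ k                     ∎
    where
    open ≡-Reasoning
    hit : Fin order → Fin (suc m) → ℕ
    hit x y = 𝟙 (enum x ∈H·? enum r ∙ ψ y)

  stabiliser-torsion : ∀ {r y} → enum r ∈H· enum r ∙ ψ y → p · y ≡ 0F
  stabiliser-torsion {r} {y} r∈ with ∈H·-conjugate r∈
  ... | v , ψy≈r⁻¹φvr = ψ-inj _ _ (begin
    ψ (p · y)                  ≈⟨ Ψ.f-· p y ⟩
    p ×ᴳ ψ y                   ≈⟨ ×-congʳ p ψy≈r⁻¹φvr ⟩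
    p ×ᴳ (g ⁻¹ ∙ (φ v ∙ g))    ≈⟨ conj-×ᴳ p g (φ v) ⟩
    g ⁻¹ ∙ (p ×ᴳ φ v ∙ g)      ≈⟨ ∙-congˡ (∙-congʳ (Φ.f-· p v)) ⟨
    g ⁻¹ ∙ (φ (p ·ᵛ v) ∙ g)    ≡⟨ cong (λ w → g ⁻¹ ∙ (φ w ∙ g)) ([1+m]·ᵛv≡0ᵛ v) ⟩
    g ⁻¹ ∙ (φ 0ᵛ ∙ g)          ≈⟨ ∙-congˡ (≈-trans (∙-congʳ Φ.f-o) (identityˡ g)) ⟩
    g ⁻¹ ∙ g                   ≈⟨ inverseˡ g ⟩
    ε                          ≈⟨ Ψ.f-o ⟨
    ψ 0F                       ∎)
    where
    open import Relation.Binary.Reasoning.Setoid setoid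
    g = enum r

  stab≤p : ∀ l → suc m ≡ p ^ l → ∀ r → stab r ≤ p
  stab≤p l n≡p^l r = ≤-trans
    (count-mono (λ y → enum r ∈H·? enum r ∙ ψ y) (λ y → p · y ≟ 0F) stabiliser-torsion)
    (count-torsion≤ p l n≡p^l)

lemma3p2 : ∀ {c ℓ : Level} (p k l : ℕ) → Prime p → (G : FiniteGroup c ℓ) →
           HasSubgroupIsoℤⁿ^ G p k → HasSubgroupIsoℤ G (p ^ l) →
           p ^ (k + l ∸ 1) ∣ FiniteGroup.order G
lemma3p2 zero k l p-prime G H K = contradiction p-prime ¬prime[0]
lemma3p2 p@(suc q) k l p-prime G H K with p ^ l in p^l≡n
... | zero  = contradiction p^l≡n (≢-nonZero⁻¹ (p ^ l) {{m^n≢0 p l}})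
... | suc m = ∣-classSizes⇒∣ _∼?_ ∼-isEquivalence (λ r →
                s*c≡p^t⇒p^[t∸1]∣c (k + l) p-prime (stab*|class|≡p^[k+l] r) (stab≤p l (sym p^l≡n) r))
  where
  open DoubleCosets G H K using (_∼?_; ∼-isEquivalence; stab; orbit-stabiliser; stab≤p)
  stab*|class|≡p^[k+l] : ∀ r → stab r * count (r ∼?_) ≡ p ^ (k + l)
  stab*|class|≡p^[k+l] r = begin
    stab r * count (r ∼?_)   ≡⟨ orbit-stabiliser r ⟩
    suc m * p ^ k            ≡⟨ cong (_* p ^ k) p^l≡n ⟨
    p ^ l * p ^ k            ≡⟨ *-comm (p ^ l) (p ^ k) ⟩
    p ^ k * p ^ l            ≡⟨ ^-distribˡ-+-* p k l ⟨
    p ^ (k + l)              ∎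
    where open ≡-Reasoning
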